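{- Let $G$ be a finite simple graph and $g$ an s-dismantlable vertex of $G$. Then $C(G\setminus g)$ is obtained from $C(G)$ by a finite sequence of deletions of weak points (each a weak point of the current poset).
   Context: For a graph $G$: $N_G(g)$ is the set of neighbours, $N_G[g]=N_G(g)\cup\{g\}$, vertex sets are identified with induced subgraphs, $G\setminus g$ is $G$ with $g$ and its incident edges removed; $g$ is dominated by $g'\ne g$ if $N_G[g]\subseteq N_G[g']$; a graph is dismantlable if it has one vertex or its vertices can be listed $g_1,\dots,g_n$ with each $g_i$ ($2\le i\le n$) dominated by another vertex in the subgraph induced by $\{g_1,\dots,g_i\}$; $g$ is s-dismantlable in $G$ if $N_G(g)$ is dismantlable. $C(G)$ is the poset of nonempty complete subgraphs of $G$ ordered by inclusion. For a finite poset $P$ and $x\in P$, $P_{<x}$, $P_{>x}$ are the subposets of elements strictly below/above $x$; $x$ is irreducible if $P_{<x}$ has a maximum or $P_{>x}$ has a minimum; $P$ is dismantlable if $P=\{x_1,\dots,x_n\}$, $n\ge1$, with each $x_i$ ($2\le i\le n$) irreducible in $\{x_1,\dots,x_i\}$; $x$ is a weak point if $P_{<x}$ or $P_{>x}$ is dismantlable. -}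

module Defs where

open import Data.Nat using (ℕ)
open import Data.Bool using (Bool; true; false)
open import Data.Fin using (Fin)
open import Data.Fin.Subset using (Subset; _∈_; _∉_; _⊆_; _-_; ⁅_⁆; Nonempty; ⊤)
open import Data.Product using (Σ; ∃; _×_; _,_)
open import Data.Sum using (_⊎_)
open import Relation.Binary.PropositionalEquality using (_≡_; _≢_)
open import Relation.Unary using (Pred; _≐_)
open import Level using (0ℓ)

record Graph (n : ℕ) : Set where
  field
    Adj   : Fin n → Fin n → Bool
    sym   : ∀ u v → Adj u v ≡ Adj v u
    irref : ∀ u → Adj u u ≡ false

open Graph public

module _ {n : ℕ} (G : Graph n) where

  -- vertex sets are identified with induced subgraphs.
  -- u ∈ N_S[v]  (closed neighbourhood of v in the induced subgraph S)
  InClosedNbhd : Subset n → Fin n → Fin n → Set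
  InClosedNbhd S v u = u ∈ S × (u ≡ v ⊎ Adj G u v ≡ true)

  Dominated : Subset n → Fin n → Fin n → Set
  Dominated S v w = w ≢ v × (∀ u → InClosedNbhd S v u → InClosedNbhd S w u)

  -- Dismantlable induced subgraph S: it has exactly one vertex, or
  -- (reading the listing g₁,…,gₖ backwards) its last vertex gₖ is dominated
  -- in S by another vertex of S and S minus gₖ is dismantlable.
  data DismantlableGraph (S : Subset n) : Set where
    single : ∀ v → S ≡ ⁅ v ⁆ → DismantlableGraph S
    remove : ∀ v w → v ∈ S → w ∈ S → Dominated S v w →
             DismantlableGraph (S - v) → DismantlableGraph S

  Nbhd : Fin n → Subset n
  Nbhd g = Data.Vec.tabulate (λ u → Adj G u g)
    where import Data.Vec

  SDismantlable : Fin n → Set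
  SDismantlable g = DismantlableGraph (Nbhd g)

  -- C(S): nonempty complete subgraphs of the induced subgraph S,
  -- as a subposet of (Subset n, ⊆)
  Complete : Subset n → Pred (Subset n) 0ℓ
  Complete S σ = Nonempty σ × σ ⊆ S ×
                 (∀ u v → u ∈ σ → v ∈ σ → u ≢ v → Adj G u v ≡ true)

-- Finite posets: subposets P of (Subset n, ⊆), given by a predicate.

module _ {n : ℕ} where

  _<_ : Subset n → Subset n → Set
  a < b = a ⊆ b × a ≢ b

  Below : Pred (Subset n) 0ℓ → Subset n → Pred (Subset n) 0ℓ
  Below P x a = P a × a < x

  Above : Pred (Subset n) 0ℓ → Subset n → Pred (Subset n) 0ℓ
  Above P x a = P a × x < a

  HasMaximum : Pred (Subset n) 0ℓ → Set
  HasMaximum Q = Σ (Subset n) λ m → Q m × (∀ a → Q a → a ⊆ m)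

  HasMinimum : Pred (Subset n) 0ℓ → Set
  HasMinimum Q = Σ (Subset n) λ m → Q m × (∀ a → Q a → m ⊆ a)

  Irreducible : Pred (Subset n) 0ℓ → Subset n → Set
  Irreducible P x = HasMaximum (Below P x) ⊎ HasMinimum (Above P x)

  Delete : Pred (Subset n) 0ℓ → Subset n → Pred (Subset n) 0ℓ
  Delete P x a = P a × a ≢ x

  -- Dismantlable poset: P = {x₁,…,xₖ}, k ≥ 1, each xᵢ (i ≥ 2) irreducible in
  -- {x₁,…,xᵢ}; read backwards: P is a singleton, or some x ∈ P is
  -- irreducible in P and P minus x is dismantlable.
  data DismantlablePoset (P : Pred (Subset n) 0ℓ) : Set where
    single : ∀ x → P ≐ (λ a → a ≡ x) → DismantlablePoset P
    remove : ∀ x → P x → Irreducible P x →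
             DismantlablePoset (Delete P x) → DismantlablePoset P

  WeakPoint : Pred (Subset n) 0ℓ → Subset n → Set
  WeakPoint P x = DismantlablePoset (Below P x) ⊎ DismantlablePoset (Above P x)

  data WeakReduces (P Q : Pred (Subset n) 0ℓ) : Set where
    done : P ≐ Q → WeakReduces P Q
    step : ∀ x → P x → WeakPoint P x →
           WeakReduces (Delete P x) Q → WeakReduces P Q

module Submission where

-- The cliques through g form the star of ⁅ g ⁆ in C(G), and deleting them smallest first leaves
-- C(G ∖ g). The first one, ⁅ g ⁆, has above it the cone over C(N(g)), which is dismantlable because
-- N(g) is: removing a vertex v dominated by w is mirrored by deleting the cliques containing v, first
-- those missing w, largest first (each then has a least upper element: add w), then the others,
-- smallest first (each then has a greatest lower element: remove v). Every later clique σ has below it exactly the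
-- nonempty subsets of σ - g, a poset with a maximum.

open import Defs hiding (sym)
open import Data.Nat using (ℕ; zero; suc; _+_; _^_; z≤n; s≤s; _≟_) renaming (_<_ to _<ℕ_; _≤_ to _≤ℕ_)
open import Data.Nat.Properties
  using (+-suc; +-identityʳ; +-cancelˡ-≡; +-monoʳ-<; +-monoʳ-≤; m≤m+n; m≤n+m; ≤-trans; <-≤-trans;
         <-irrefl; <-asym; ≤∧≢⇒<; n<1+n; m<n⇒m<1+n; m<1+n⇒m<n∨m≡n)
open import Data.Bool using (true; false)
import Data.Bool.Properties as Bool
open import Data.Vec.Base using ([]; _∷_; here; there)
open import Data.Vec.Properties using (≡-dec; []=⇒lookup; lookup⇒[]=; lookup∘tabulate)
open import Data.Fin using (Fin)
open import Data.Fin.Properties using (any?; all?) renaming (_≟_ to _≟ᶠ_)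
open import Data.Fin.Subset using (Subset; _∈_; _∉_; _⊆_; _∪_; _─_; _-_; ⁅_⁆; Nonempty; ⊤; ∁)
open import Data.Fin.Subset.Properties
  using (_∈?_; _⊆?_; nonempty?; anySubset?; ⊆-refl; ⊆-reflexive; ⊆-antisym; ⊆⊤; drop-∷-⊆;
         p⊆q⇒∁p⊇∁q; ∁p⊆∁q⇒p⊇q; x∈⁅x⁆; x∈⁅y⁆⇒x≡y; x∈p∪q⁻; p⊆p∪q; q⊆p∪q; p─q⊆p; x∈p∧x≢y⇒x∈p-y)
open import Data.Product using (_×_; _,_; proj₁; proj₂; map₁; ∃)
open import Data.Sum using (inj₁; inj₂)
open import Data.Empty using (⊥-elim)
open import Function using (_∘_; case_of_)
open import Relation.Nullary using (¬_; Dec; yes; no)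
open import Relation.Nullary.Decidable using (_×-dec_; _→-dec_; ¬?; decidable-stable)
open import Relation.Binary.PropositionalEquality using (_≡_; _≢_; refl; sym; trans; cong; subst)
open import Relation.Unary using (Pred; Decidable; _≐_; _∩_; _∖_)
open import Relation.Unary.Properties using (≐-sym; ≐-trans; _∩?_; ∁?)
open import Level using (0ℓ)

Family : ℕ → Set₁
Family n = Pred (Subset n) 0ℓ

private variable
  n : ℕ
  P Q R : Family n
  x : Subset n

delete-resp-≐ : P ≐ Q → Delete P x ≐ Delete Q x
delete-resp-≐ (P⊆Q , Q⊆P) = map₁ P⊆Q , map₁ Q⊆P

below-resp-≐ : P ≐ Q → Below P x ≐ Below Q x
below-resp-≐ (P⊆Q , Q⊆P) = map₁ P⊆Q , map₁ Q⊆P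

above-resp-≐ : P ≐ Q → Above P x ≐ Above Q x
above-resp-≐ (P⊆Q , Q⊆P) = map₁ P⊆Q , map₁ Q⊆P

hasMaximum-resp-≐ : P ≐ Q → HasMaximum P → HasMaximum Q
hasMaximum-resp-≐ (P⊆Q , Q⊆P) (m , Pm , max) = m , P⊆Q Pm , λ a → max a ∘ Q⊆P

hasMinimum-resp-≐ : P ≐ Q → HasMinimum P → HasMinimum Q
hasMinimum-resp-≐ (P⊆Q , Q⊆P) (m , Pm , min) = m , P⊆Q Pm , λ a → min a ∘ Q⊆P

irreducible-resp-≐ : P ≐ Q → Irreducible P x → Irreducible Q x
irreducible-resp-≐ P≐Q (inj₁ max) = inj₁ (hasMaximum-resp-≐ (below-resp-≐ P≐Q) max)
irreducible-resp-≐ P≐Q (inj₂ min) = inj₂ (hasMinimum-resp-≐ (above-resp-≐ P≐Q) min)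

dismantlable-resp-≐ : P ≐ Q → DismantlablePoset P → DismantlablePoset Q
dismantlable-resp-≐ P≐Q (single x P≐x) = single x (≐-trans (≐-sym P≐Q) P≐x)
dismantlable-resp-≐ P≐Q@(P⊆Q , _) (remove x Px irr D) =
  remove x (P⊆Q Px) (irreducible-resp-≐ P≐Q irr) (dismantlable-resp-≐ (delete-resp-≐ P≐Q) D)

weakPoint-resp-≐ : P ≐ Q → WeakPoint P x → WeakPoint Q x
weakPoint-resp-≐ P≐Q (inj₁ D) = inj₁ (dismantlable-resp-≐ (below-resp-≐ P≐Q) D)
weakPoint-resp-≐ P≐Q (inj₂ D) = inj₂ (dismantlable-resp-≐ (above-resp-≐ P≐Q) D)

data Deletions {n} (Good : Family n → Subset n → Set) (P Q : Family n) : Set₁ where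
  done : P ≐ Q → Deletions Good P Q
  step : ∀ x → P x → Good P x → Deletions Good (Delete P x) Q → Deletions Good P Q

deletions-resp-≐ʳ : ∀ {Good} → Q ≐ R → Deletions Good P Q → Deletions Good P R
deletions-resp-≐ʳ Q≐R (done P≐Q) = done (≐-trans P≐Q Q≐R)
deletions-resp-≐ʳ Q≐R (step x Px good D) = step x Px good (deletions-resp-≐ʳ Q≐R D)

irreducibleDeletions-dismantlable : Deletions Irreducible P Q → DismantlablePoset Q → DismantlablePoset P
irreducibleDeletions-dismantlable (done P≐Q) D = dismantlable-resp-≐ (≐-sym P≐Q) D
irreducibleDeletions-dismantlable (step x Px irr Ds) D = remove x Px irr (irreducibleDeletions-dismantlable Ds D)

weakPointDeletions⇒weakReduces : Deletions WeakPoint P Q → WeakReduces P Q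
weakPointDeletions⇒weakReduces (done P≐Q) = done P≐Q
weakPointDeletions⇒weakReduces (step x Px weak Ds) = step x Px weak (weakPointDeletions⇒weakReduces Ds)

-- Reading a as a binary numeral gives a linear extension of ⊂ (rank-mono-<).
rank : Subset n → ℕ
rank [] = 0
rank {suc n} (true ∷ a) = 2 ^ n + rank a
rank (false ∷ a) = rank a

rank<2^n : (a : Subset n) → rank a <ℕ 2 ^ n
rank<2^n [] = s≤s z≤n
rank<2^n {suc n} (true ∷ a) = <-≤-trans (+-monoʳ-< (2 ^ n) (rank<2^n a)) (+-monoʳ-≤ (2 ^ n) (m≤m+n (2 ^ n) 0))
rank<2^n {suc n} (false ∷ a) = <-≤-trans (rank<2^n a) (m≤m+n (2 ^ n) _)

rank-injective : ∀ {a b : Subset n} → rank a ≡ rank b → a ≡ b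
rank-injective {a = []} {[]} _ = refl
rank-injective {suc n} {true ∷ a} {true ∷ b} eq = cong (true ∷_) (rank-injective (+-cancelˡ-≡ (2 ^ n) _ _ eq))
rank-injective {a = false ∷ a} {false ∷ b} eq = cong (false ∷_) (rank-injective eq)
rank-injective {suc n} {true ∷ a} {false ∷ b} eq =
  ⊥-elim (<-irrefl refl (<-≤-trans (rank<2^n b) (subst (2 ^ n ≤ℕ_) eq (m≤m+n (2 ^ n) (rank a)))))
rank-injective {suc n} {false ∷ a} {true ∷ b} eq =
  ⊥-elim (<-irrefl refl (<-≤-trans (rank<2^n a) (subst (2 ^ n ≤ℕ_) (sym eq) (m≤m+n (2 ^ n) (rank b)))))

rank-mono-⊆ : ∀ (a b : Subset n) → a ⊆ b → rank a ≤ℕ rank b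
rank-mono-⊆ [] [] _ = z≤n
rank-mono-⊆ {suc n} (true ∷ a) (true ∷ b) a⊆b = +-monoʳ-≤ (2 ^ n) (rank-mono-⊆ a b (drop-∷-⊆ a⊆b))
rank-mono-⊆ (false ∷ a) (false ∷ b) a⊆b = rank-mono-⊆ a b (drop-∷-⊆ a⊆b)
rank-mono-⊆ {suc n} (false ∷ a) (true ∷ b) a⊆b = ≤-trans (rank-mono-⊆ a b (drop-∷-⊆ a⊆b)) (m≤n+m (rank b) (2 ^ n))
rank-mono-⊆ (true ∷ a) (false ∷ b) a⊆b with a⊆b here
... | ()

rank-mono-< : ∀ {a b : Subset n} → a < b → rank a <ℕ rank b
rank-mono-< {a = a} {b} (a⊆b , a≢b) = ≤∧≢⇒< (rank-mono-⊆ a b a⊆b) (a≢b ∘ rank-injective)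

corank : Subset n → ℕ
corank a = rank (∁ a)

∁-injective : ∀ {a b : Subset n} → ∁ a ≡ ∁ b → a ≡ b
∁-injective eq = ⊆-antisym (∁p⊆∁q⇒p⊇q (⊆-reflexive (sym eq))) (∁p⊆∁q⇒p⊇q (⊆-reflexive eq))

corank-injective : ∀ {a b : Subset n} → corank a ≡ corank b → a ≡ b
corank-injective = ∁-injective ∘ rank-injective

corank-anti-< : ∀ {a b : Subset n} → a < b → corank b <ℕ corank a
corank-anti-< (a⊆b , a≢b) = rank-mono-< (p⊆q⇒∁p⊇∁q a⊆b , a≢b ∘ ∁-injective ∘ sym)

corank<2^n : (a : Subset n) → corank a <ℕ 2 ^ n
corank<2^n a = rank<2^n (∁ a)

Pruned : Family n → Family n → (Subset n → ℕ) → ℕ → Family n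
Pruned P T r k a = P a × ¬ (T a × r a <ℕ k)

module Peeling {n} (P T : Family n) (r : Subset n → ℕ) (r-injective : ∀ {a b} → r a ≡ r b → a ≡ b) where

  pruned-zero : Pruned P T r 0 ≐ P
  pruned-zero = proj₁ , λ Pa → Pa , λ ()

  pruned-bound : ∀ {K} → (∀ a → r a <ℕ K) → Pruned P T r K ≐ P ∖ T
  pruned-bound r<K = (λ (Pa , unpruned) → Pa , λ Ta → unpruned (Ta , r<K _)) , λ (Pa , ¬Ta) → Pa , ¬Ta ∘ proj₁

  pruned-suc-hit : ∀ {k x} → r x ≡ k → T x → Pruned P T r (suc k) ≐ Delete (Pruned P T r k) x
  pruned-suc-hit {k} {x} rx≡k Tx = forward , backward
    where
    forward : ∀ {a} → Pruned P T r (suc k) a → Delete (Pruned P T r k) x a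
    forward (Pa , unpruned) = (Pa , λ (Ta , ra<k) → unpruned (Ta , m<n⇒m<1+n ra<k)) ,
      λ { refl → unpruned (Tx , subst (_<ℕ suc k) (sym rx≡k) (n<1+n k)) }
    backward : ∀ {a} → Delete (Pruned P T r k) x a → Pruned P T r (suc k) a
    backward ((Pa , unpruned) , a≢x) = Pa , λ (Ta , ra<1+k) → case m<1+n⇒m<n∨m≡n ra<1+k of λ where
      (inj₁ ra<k) → unpruned (Ta , ra<k)
      (inj₂ ra≡k) → a≢x (r-injective (trans ra≡k (sym rx≡k)))

  pruned-suc-miss : ∀ {k} → (∀ x → r x ≡ k → T x → ¬ P x) → Pruned P T r (suc k) ≐ Pruned P T r k
  pruned-suc-miss {k} none = forward , backward
    where
    forward : ∀ {a} → Pruned P T r (suc k) a → Pruned P T r k a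
    forward (Pa , unpruned) = Pa , λ (Ta , ra<k) → unpruned (Ta , m<n⇒m<1+n ra<k)
    backward : ∀ {a} → Pruned P T r k a → Pruned P T r (suc k) a
    backward {a} (Pa , unpruned) = Pa , λ (Ta , ra<1+k) → case m<1+n⇒m<n∨m≡n ra<1+k of λ where
      (inj₁ ra<k) → unpruned (Ta , ra<k)
      (inj₂ ra≡k) → none a ra≡k Ta Pa

  above-pruned : (∀ {a b} → a < b → r a <ℕ r b) → ∀ x → Above (Pruned P T r (r x)) x ≐ Above P x
  above-pruned r-mono x = map₁ proj₁ , λ (Pa , x<a) → (Pa , λ (_ , ra<rx) → <-asym ra<rx (r-mono x<a)) , x<a

  module _ {Good : Family n → Subset n → Set} (good-resp-≐ : ∀ {P Q x} → P ≐ Q → Good P x → Good Q x)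
           {K} (r<K : ∀ a → r a <ℕ K) (T∩P? : Decidable (T ∩ P))
           (good : ∀ x → P x → T x → Good (Pruned P T r (r x)) x) where

    peel-from : ∀ d k → d + k ≡ K → ∀ {Q} → Q ≐ Pruned P T r k → Deletions Good Q (P ∖ T)
    peel-from zero k refl Q≐ = done (≐-trans Q≐ (pruned-bound r<K))
    peel-from (suc d) k d+k≡K Q≐ with anySubset? (λ x → (r x ≟ k) ×-dec T∩P? x)
    ... | yes (x , refl , Tx , Px) =
      step x (proj₂ Q≐ (Px , λ (_ , rx<rx) → <-irrefl refl rx<rx)) (good-resp-≐ (≐-sym Q≐) (good x Px Tx))
        (peel-from d (suc k) (trans (+-suc d k) d+k≡K) (≐-trans (delete-resp-≐ Q≐) (≐-sym (pruned-suc-hit refl Tx))))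
    ... | no ∄x = peel-from d (suc k) (trans (+-suc d k) d+k≡K)
      (≐-trans Q≐ (≐-sym (pruned-suc-miss λ x rx≡k Tx Px → ∄x (x , rx≡k , Tx , Px))))

    peel : Deletions Good P (P ∖ T)
    peel = peel-from K 0 (+-identityʳ K) (≐-sym pruned-zero)

_≟ˢ_ : (a b : Subset n) → Dec (a ≡ b)
_≟ˢ_ = ≡-dec Bool._≟_

hasMaximum⇒dismantlable : {P : Family n} → Decidable P → HasMaximum P → DismantlablePoset P
hasMaximum⇒dismantlable {n} {P} P? (m , Pm , max) =
  irreducibleDeletions-dismantlable
    (peel irreducible-resp-≐ corank<2^n (∁? (_≟ˢ m) ∩? P?) maximum-least-above)
    (single m ((λ {a} (_ , ¬a≢m) → decidable-stable (a ≟ˢ m) ¬a≢m) , λ { refl → Pm , λ m≢m → m≢m refl }))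
  where
  open Peeling P (_≢ m) corank corank-injective
  maximum-least-above : ∀ x → P x → x ≢ m → Irreducible (Pruned P (_≢ m) corank (corank x)) x
  maximum-least-above x Px x≢m = inj₂ (m , ((Pm , λ (m≢m , _) → m≢m refl) , max x Px , x≢m) , least)
    where
    least : ∀ a → Above (Pruned P (_≢ m) corank (corank x)) x a → m ⊆ a
    least a ((_ , unpruned) , x<a) with a ≟ˢ m
    ... | yes refl = ⊆-refl
    ... | no a≢m = ⊥-elim (unpruned (a≢m , corank-anti-< x<a))

x∈p─q⇒x∉q : ∀ (p q : Subset n) {x} → x ∈ p ─ q → x ∉ q
x∈p─q⇒x∉q (_ ∷ p) (true ∷ q) () here
x∈p─q⇒x∉q (_ ∷ p) (_ ∷ q) (there x∈p─q) (there x∈q) = x∈p─q⇒x∉q p q x∈p─q x∈q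

x∉p-x : ∀ (p : Subset n) x → x ∉ p - x
x∉p-x p x x∈p-x = x∈p─q⇒x∉q p ⁅ x ⁆ x∈p-x (x∈⁅x⁆ x)

x∈p⇒⁅x⁆⊆p : ∀ {x} {p : Subset n} → x ∈ p → ⁅ x ⁆ ⊆ p
x∈p⇒⁅x⁆⊆p {x = x} x∈p y∈⁅x⁆ = subst (_∈ _) (sym (x∈⁅y⁆⇒x≡y x y∈⁅x⁆)) x∈p

p⊆r∧x∈r⇒p∪⁅x⁆⊆r : ∀ {p r : Subset n} {x} → p ⊆ r → x ∈ r → p ∪ ⁅ x ⁆ ⊆ r
p⊆r∧x∈r⇒p∪⁅x⁆⊆r {p = p} {x = x} p⊆r x∈r y∈ with x∈p∪q⁻ p ⁅ x ⁆ y∈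
... | inj₁ y∈p = p⊆r y∈p
... | inj₂ y∈⁅x⁆ = x∈p⇒⁅x⁆⊆p x∈r y∈⁅x⁆

x∈p∧p≢⁅x⁆⇒∃≢x : ∀ {x} {p : Subset n} → x ∈ p → p ≢ ⁅ x ⁆ → ∃ λ y → y ∈ p × y ≢ x
x∈p∧p≢⁅x⁆⇒∃≢x {x = x} {p} x∈p p≢⁅x⁆ with any? (λ y → (y ∈? p) ×-dec ¬? (y ≟ᶠ x))
... | yes y = y
... | no ∄y = ⊥-elim (p≢⁅x⁆ (⊆-antisym p⊆⁅x⁆ (x∈p⇒⁅x⁆⊆p x∈p)))
  where
  p⊆⁅x⁆ : p ⊆ ⁅ x ⁆
  p⊆⁅x⁆ {y} y∈p with y ≟ᶠ x
  ... | yes refl = x∈⁅x⁆ x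
  ... | no y≢x = ⊥-elim (∄y (y , y∈p , y≢x))

module _ (G : Graph n) where

  IsClique : Subset n → Set
  IsClique σ = ∀ u v → u ∈ σ → v ∈ σ → u ≢ v → Adj G u v ≡ true

  isClique? : Decidable IsClique
  isClique? σ = all? λ u → all? λ v →
    (u ∈? σ) →-dec (v ∈? σ) →-dec ¬? (u ≟ᶠ v) →-dec (Adj G u v Bool.≟ true)

  complete? : ∀ S → Decidable (Complete G S)
  complete? S σ = nonempty? σ ×-dec (σ ⊆? S) ×-dec isClique? σ

  isClique-⊆ : ∀ {σ τ} → σ ⊆ τ → IsClique τ → IsClique σ
  isClique-⊆ σ⊆τ clique u v u∈σ v∈σ = clique u v (σ⊆τ u∈σ) (σ⊆τ v∈σ)

  isClique-⁅⁆ : ∀ u → IsClique ⁅ u ⁆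
  isClique-⁅⁆ u v v' v∈ v'∈ v≢v' = ⊥-elim (v≢v' (trans (x∈⁅y⁆⇒x≡y u v∈) (sym (x∈⁅y⁆⇒x≡y u v'∈))))

  isClique-∪⁅⁆ : ∀ {σ w} → IsClique σ → (∀ u → u ∈ σ → u ≢ w → Adj G u w ≡ true) → IsClique (σ ∪ ⁅ w ⁆)
  isClique-∪⁅⁆ {σ} {w} clique adj u v u∈ v∈ u≢v with x∈p∪q⁻ σ ⁅ w ⁆ u∈ | x∈p∪q⁻ σ ⁅ w ⁆ v∈
  ... | inj₁ u∈σ | inj₁ v∈σ = clique u v u∈σ v∈σ u≢v
  ... | inj₁ u∈σ | inj₂ v∈⁅w⁆ with refl ← x∈⁅y⁆⇒x≡y w v∈⁅w⁆ = adj u u∈σ u≢v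
  ... | inj₂ u∈⁅w⁆ | inj₁ v∈σ with refl ← x∈⁅y⁆⇒x≡y w u∈⁅w⁆ = trans (Graph.sym G u v) (adj v v∈σ (u≢v ∘ sym))
  ... | inj₂ u∈⁅w⁆ | inj₂ v∈⁅w⁆ = isClique-⁅⁆ w u v u∈⁅w⁆ v∈⁅w⁆ u≢v

  complete-∖-≐ : ∀ S g → Complete G S ∖ (g ∈_) ≐ Complete G (S - g)
  complete-∖-≐ S g = forward , backward
    where
    forward : ∀ {σ} → (Complete G S ∖ (g ∈_)) σ → Complete G (S - g) σ
    forward ((ne , σ⊆S , clique) , g∉σ) = ne , (λ u∈σ → x∈p∧x≢y⇒x∈p-y (σ⊆S u∈σ) λ { refl → g∉σ u∈σ }) , clique
    backward : ∀ {σ} → Complete G (S - g) σ → (Complete G S ∖ (g ∈_)) σ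
    backward (ne , σ⊆S-g , clique) = (ne , p─q⊆p S ⁅ g ⁆ ∘ σ⊆S-g , clique) , x∉p-x S g ∘ σ⊆S-g

  module _ {g : Fin n} where

    ∈Nbhd⁺ : ∀ {u} → Adj G u g ≡ true → u ∈ Nbhd G g
    ∈Nbhd⁺ {u} adj = lookup⇒[]= u _ (trans (lookup∘tabulate (λ v → Adj G v g) u) adj)

    ∈Nbhd⁻ : ∀ {u} → u ∈ Nbhd G g → Adj G u g ≡ true
    ∈Nbhd⁻ {u} u∈N = trans (sym (lookup∘tabulate (λ v → Adj G v g) u)) ([]=⇒lookup u∈N)

    ∈Nbhd⇒≢ : ∀ {u} → u ∈ Nbhd G g → u ≢ g
    ∈Nbhd⇒≢ {u} u∈N refl with () ← trans (sym (∈Nbhd⁻ u∈N)) (irref G u)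

module Apex (G : Graph n) (g : Fin n) where

  -- For S ⊆ N(g), σ ↦ σ ∪ ⁅ g ⁆ is an isomorphism from C(S) onto Cone S.
  Cone : Subset n → Family n
  Cone S σ = Complete G ⊤ σ × g ∈ σ × (∀ u → u ∈ σ → u ≢ g → u ∈ S) × ∃ (λ u → u ∈ σ × u ≢ g)

  cone? : ∀ S → Decidable (Cone S)
  cone? S σ = complete? G ⊤ σ ×-dec (g ∈? σ)
    ×-dec all? (λ u → (u ∈? σ) →-dec ¬? (u ≟ᶠ g) →-dec (u ∈? S))
    ×-dec any? (λ u → (u ∈? σ) ×-dec ¬? (u ≟ᶠ g))

  cone-singleton : ∀ {S v} → S ⊆ Nbhd G g → S ≡ ⁅ v ⁆ → DismantlablePoset (Cone S)
  cone-singleton {S} {v} S⊆N refl = single edge (⊆-edge , λ { refl → cone-edge })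
    where
    edge : Subset n
    edge = ⁅ g ⁆ ∪ ⁅ v ⁆
    v≢g : v ≢ g
    v≢g = ∈Nbhd⇒≢ G (S⊆N (x∈⁅x⁆ v))
    g∈edge : g ∈ edge
    g∈edge = p⊆p∪q ⁅ v ⁆ (x∈⁅x⁆ g)
    v∈edge : v ∈ edge
    v∈edge = q⊆p∪q ⁅ g ⁆ ⁅ v ⁆ (x∈⁅x⁆ v)
    cone-edge : Cone S edge
    cone-edge = ((g , g∈edge) , ⊆⊤ , isClique-∪⁅⁆ G (isClique-⁅⁆ G g) adj-g) , g∈edge , in-S , (v , v∈edge , v≢g)
      where
      adj-g : ∀ u → u ∈ ⁅ g ⁆ → u ≢ v → Adj G u v ≡ true
      adj-g u u∈⁅g⁆ _ with refl ← x∈⁅y⁆⇒x≡y g u∈⁅g⁆ = trans (Graph.sym G g v) (∈Nbhd⁻ G (S⊆N (x∈⁅x⁆ v)))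
      in-S : ∀ u → u ∈ edge → u ≢ g → u ∈ ⁅ v ⁆
      in-S u u∈edge u≢g with x∈p∪q⁻ ⁅ g ⁆ ⁅ v ⁆ u∈edge
      ... | inj₁ u∈⁅g⁆ = ⊥-elim (u≢g (x∈⁅y⁆⇒x≡y g u∈⁅g⁆))
      ... | inj₂ u∈⁅v⁆ = u∈⁅v⁆
    ⊆-edge : ∀ {σ} → Cone S σ → σ ≡ edge
    ⊆-edge {σ} (_ , g∈σ , σ⊆S , (u , u∈σ , u≢g)) =
      ⊆-antisym σ⊆edge (p⊆r∧x∈r⇒p∪⁅x⁆⊆r (x∈p⇒⁅x⁆⊆p g∈σ) (subst (_∈ σ) (x∈⁅y⁆⇒x≡y v (σ⊆S u u∈σ u≢g)) u∈σ))
      where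
      σ⊆edge : σ ⊆ edge
      σ⊆edge {u} u∈σ with u ≟ᶠ g
      ... | yes refl = g∈edge
      ... | no u≢g = q⊆p∪q ⁅ g ⁆ ⁅ v ⁆ (σ⊆S u u∈σ u≢g)

  module RemoveDominated {S v w} (S⊆N : S ⊆ Nbhd G g) (v∈S : v ∈ S) (w∈S : w ∈ S) (v≼w : Dominated G S v w) where

    w≢v : w ≢ v
    w≢v = proj₁ v≼w

    w≢g : w ≢ g
    w≢g = ∈Nbhd⇒≢ G (S⊆N w∈S)

    v≢g : v ≢ g
    v≢g = ∈Nbhd⇒≢ G (S⊆N v∈S)

    VWithoutW : Family n
    VWithoutW σ = v ∈ σ × w ∉ σ

    inClosedNbhd-v : ∀ {σ u} → Cone S σ → v ∈ σ → u ∈ σ → u ≢ g → InClosedNbhd G S v u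
    inClosedNbhd-v {u = u} ((_ , _ , clique) , _ , σ⊆S , _) v∈σ u∈σ u≢g with u ≟ᶠ v
    ... | yes u≡v = σ⊆S u u∈σ u≢g , inj₁ u≡v
    ... | no u≢v = σ⊆S u u∈σ u≢g , inj₂ (clique u v u∈σ v∈σ u≢v)

    adjacent-dominator : ∀ {σ} → Cone S σ → v ∈ σ → ∀ u → u ∈ σ → u ≢ w → Adj G u w ≡ true
    adjacent-dominator Cσ v∈σ u u∈σ u≢w with u ≟ᶠ g
    ... | yes refl = trans (Graph.sym G g w) (∈Nbhd⁻ G (S⊆N w∈S))
    ... | no u≢g with proj₂ v≼w u (inClosedNbhd-v Cσ v∈σ u∈σ u≢g)
    ...   | _ , inj₁ u≡w = ⊥-elim (u≢w u≡w)
    ...   | _ , inj₂ adj = adj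

    cone-∪-dominator : ∀ {σ} → Cone S σ → v ∈ σ → Cone S (σ ∪ ⁅ w ⁆)
    cone-∪-dominator {σ} Cσ@((_ , _ , clique) , g∈σ , σ⊆S , (u , u∈σ , u≢g)) v∈σ =
      ((w , q⊆p∪q σ ⁅ w ⁆ (x∈⁅x⁆ w)) , ⊆⊤ , isClique-∪⁅⁆ G clique (adjacent-dominator Cσ v∈σ)) ,
      p⊆p∪q ⁅ w ⁆ g∈σ , in-S , (u , p⊆p∪q ⁅ w ⁆ u∈σ , u≢g)
      where
      in-S : ∀ x → x ∈ σ ∪ ⁅ w ⁆ → x ≢ g → x ∈ S
      in-S x x∈ x≢g with x∈p∪q⁻ σ ⁅ w ⁆ x∈
      ... | inj₁ x∈σ = σ⊆S x x∈σ x≢g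
      ... | inj₂ x∈⁅w⁆ = x∈p⇒⁅x⁆⊆p w∈S x∈⁅w⁆

    cone-minus-dominated : ∀ {σ} → Cone S σ → w ∈ σ → Cone S (σ - v)
    cone-minus-dominated {σ} ((_ , _ , clique) , g∈σ , σ⊆S , _) w∈σ =
      ((w , w∈σ-v) , ⊆⊤ , isClique-⊆ G (p─q⊆p σ ⁅ v ⁆) clique) , x∈p∧x≢y⇒x∈p-y g∈σ (v≢g ∘ sym) ,
      (λ u u∈ u≢g → σ⊆S u (p─q⊆p σ ⁅ v ⁆ u∈) u≢g) , (w , w∈σ-v , w≢g)
      where
      w∈σ-v : w ∈ σ - v
      w∈σ-v = x∈p∧x≢y⇒x∈p-y w∈σ w≢v

    least-above-adds-dominator : ∀ σ → Cone S σ → VWithoutW σ → Irreducible (Pruned (Cone S) VWithoutW corank (corank σ)) σ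
    least-above-adds-dominator σ Cσ (v∈σ , w∉σ) =
      inj₂ (σ ∪ ⁅ w ⁆ , ((cone-∪-dominator Cσ v∈σ , λ ((_ , w∉) , _) → w∉ w∈σ∪w) ,
                         p⊆p∪q ⁅ w ⁆ , λ σ≡ → w∉σ (subst (w ∈_) (sym σ≡) w∈σ∪w)) , least)
      where
      w∈σ∪w : w ∈ σ ∪ ⁅ w ⁆
      w∈σ∪w = q⊆p∪q σ ⁅ w ⁆ (x∈⁅x⁆ w)
      least : ∀ a → Above (Pruned (Cone S) VWithoutW corank (corank σ)) σ a → σ ∪ ⁅ w ⁆ ⊆ a
      least a ((_ , unpruned) , σ<a@(σ⊆a , _)) with w ∈? a
      ... | yes w∈a = p⊆r∧x∈r⇒p∪⁅x⁆⊆r σ⊆a w∈a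
      ... | no w∉a = ⊥-elim (unpruned ((σ⊆a v∈σ , w∉a) , corank-anti-< σ<a))

    greatest-below-removes-dominated : ∀ σ → (Cone S ∖ VWithoutW) σ → v ∈ σ → Irreducible (Pruned (Cone S ∖ VWithoutW) (v ∈_) rank (rank σ)) σ
    greatest-below-removes-dominated σ (Cσ , ¬vw) v∈σ =
      inj₁ (σ - v , (((cone-minus-dominated Cσ w∈σ , v∉σ-v ∘ proj₁) , v∉σ-v ∘ proj₁) ,
                     p─q⊆p σ ⁅ v ⁆ , λ σ-v≡σ → v∉σ-v (subst (v ∈_) (sym σ-v≡σ) v∈σ)) , greatest)
      where
      v∉σ-v : v ∉ σ - v
      v∉σ-v = x∉p-x σ v
      w∈σ : w ∈ σ
      w∈σ with w ∈? σ
      ... | yes w∈σ = w∈σ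
      ... | no w∉σ = ⊥-elim (¬vw (v∈σ , w∉σ))
      greatest : ∀ a → Below (Pruned (Cone S ∖ VWithoutW) (v ∈_) rank (rank σ)) σ a → a ⊆ σ - v
      greatest a ((_ , unpruned) , a<σ@(a⊆σ , _)) u∈a =
        x∈p∧x≢y⇒x∈p-y (a⊆σ u∈a) λ { refl → unpruned (u∈a , rank-mono-< a<σ) }

    cone-∖-dominated : (Cone S ∖ VWithoutW) ∖ (v ∈_) ≐ Cone (S - v)
    cone-∖-dominated = forward , backward
      where
      forward : ∀ {σ} → ((Cone S ∖ VWithoutW) ∖ (v ∈_)) σ → Cone (S - v) σ
      forward (((Cσ , g∈σ , σ⊆S , other) , _) , v∉σ) =
        Cσ , g∈σ , (λ u u∈σ u≢g → x∈p∧x≢y⇒x∈p-y (σ⊆S u u∈σ u≢g) λ { refl → v∉σ u∈σ }) , other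
      backward : ∀ {σ} → Cone (S - v) σ → ((Cone S ∖ VWithoutW) ∖ (v ∈_)) σ
      backward {σ} (Cσ , g∈σ , σ⊆S-v , other) =
        ((Cσ , g∈σ , (λ u u∈σ u≢g → p─q⊆p S ⁅ v ⁆ (σ⊆S-v u u∈σ u≢g)) , other) , v∉σ ∘ proj₁) , v∉σ
        where
        v∉σ : v ∉ σ
        v∉σ v∈σ = x∉p-x S v (σ⊆S-v v v∈σ v≢g)

    cone-remove-dominated : DismantlablePoset (Cone (S - v)) → DismantlablePoset (Cone S)
    cone-remove-dominated D =
      irreducibleDeletions-dismantlable
        (Peeling.peel (Cone S) VWithoutW corank corank-injective irreducible-resp-≐ corank<2^n
          (VWithoutW? ∩? cone? S) least-above-adds-dominator)
        (irreducibleDeletions-dismantlable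
          (deletions-resp-≐ʳ cone-∖-dominated
            (Peeling.peel (Cone S ∖ VWithoutW) (v ∈_) rank rank-injective irreducible-resp-≐ rank<2^n
              ((v ∈?_) ∩? (cone? S ∩? ∁? VWithoutW?)) greatest-below-removes-dominated))
          D)
      where
      VWithoutW? : Decidable VWithoutW
      VWithoutW? σ = (v ∈? σ) ×-dec ¬? (w ∈? σ)

  cone-dismantlable : ∀ {S} → S ⊆ Nbhd G g → DismantlableGraph G S → DismantlablePoset (Cone S)
  cone-dismantlable S⊆N (single v S≡⁅v⁆) = cone-singleton S⊆N S≡⁅v⁆
  cone-dismantlable {S} S⊆N (remove v w v∈S w∈S v≼w D) =
    RemoveDominated.cone-remove-dominated S⊆N v∈S w∈S v≼w (cone-dismantlable (S⊆N ∘ p─q⊆p S ⁅ v ⁆) D)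

  cone-Nbhd≐above : Cone (Nbhd G g) ≐ Above (Complete G ⊤) ⁅ g ⁆
  cone-Nbhd≐above = forward , backward
    where
    forward : ∀ {σ} → Cone (Nbhd G g) σ → Above (Complete G ⊤) ⁅ g ⁆ σ
    forward {σ} (Cσ , g∈σ , _ , (u , u∈σ , u≢g)) =
      Cσ , x∈p⇒⁅x⁆⊆p g∈σ , λ ⁅g⁆≡σ → u≢g (x∈⁅y⁆⇒x≡y g (subst (u ∈_) (sym ⁅g⁆≡σ) u∈σ))
    backward : ∀ {σ} → Above (Complete G ⊤) ⁅ g ⁆ σ → Cone (Nbhd G g) σ
    backward {σ} (Cσ@(_ , _ , clique) , ⁅g⁆⊆σ , ⁅g⁆≢σ) =
      Cσ , g∈σ , (λ u u∈σ u≢g → ∈Nbhd⁺ G (clique u g u∈σ g∈σ u≢g)) , x∈p∧p≢⁅x⁆⇒∃≢x g∈σ (⁅g⁆≢σ ∘ sym)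
      where
      g∈σ : g ∈ σ
      g∈σ = ⁅g⁆⊆σ (x∈⁅x⁆ g)

module _ (G : Graph n) (g : Fin n) where
  open Apex G g

  below-star : ∀ {σ} → Complete G ⊤ σ → g ∈ σ →
               Below (Pruned (Complete G ⊤) (g ∈_) rank (rank σ)) σ ≐ (λ a → Nonempty a × a ⊆ σ - g)
  below-star {σ} (_ , _ , clique) g∈σ = forward , backward
    where
    forward : ∀ {a} → Below (Pruned (Complete G ⊤) (g ∈_) rank (rank σ)) σ a → Nonempty a × a ⊆ σ - g
    forward (((ne , _) , unpruned) , a<σ@(a⊆σ , _)) =
      ne , λ u∈a → x∈p∧x≢y⇒x∈p-y (a⊆σ u∈a) λ { refl → unpruned (u∈a , rank-mono-< a<σ) }
    backward : ∀ {a} → Nonempty a × a ⊆ σ - g → Below (Pruned (Complete G ⊤) (g ∈_) rank (rank σ)) σ a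
    backward {a} (ne , a⊆σ-g) =
      ((ne , ⊆⊤ , isClique-⊆ G a⊆σ clique) , g∉a ∘ proj₁) , a⊆σ , λ { refl → g∉a g∈σ }
      where
      a⊆σ : a ⊆ σ
      a⊆σ = p─q⊆p σ ⁅ g ⁆ ∘ a⊆σ-g
      g∉a : g ∉ a
      g∉a = x∉p-x σ g ∘ a⊆σ-g

  star-weakPoint : SDismantlable G g → ∀ σ → Complete G ⊤ σ → g ∈ σ →
                   WeakPoint (Pruned (Complete G ⊤) (g ∈_) rank (rank σ)) σ
  star-weakPoint sd σ Cσ g∈σ with σ ≟ˢ ⁅ g ⁆
  ... | yes refl = inj₂ (dismantlable-resp-≐
          (≐-trans cone-Nbhd≐above (≐-sym (Peeling.above-pruned (Complete G ⊤) (g ∈_) rank rank-injective rank-mono-< σ)))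
          (cone-dismantlable (λ u∈N → u∈N) sd))
  ... | no σ≢⁅g⁆ = inj₁ (dismantlable-resp-≐ (≐-sym (below-star Cσ g∈σ))
          (hasMaximum⇒dismantlable (nonempty? ∩? (_⊆? σ - g)) (σ - g , (σ-g-nonempty , ⊆-refl) , λ _ → proj₂)))
    where
    σ-g-nonempty : Nonempty (σ - g)
    σ-g-nonempty with u , u∈σ , u≢g ← x∈p∧p≢⁅x⁆⇒∃≢x g∈σ σ≢⁅g⁆ = u , x∈p∧x≢y⇒x∈p-y u∈σ u≢g

proposition3p4 : (n : ℕ) (G : Graph n) (g : Fin n) → SDismantlable G g →
    WeakReduces (Complete G ⊤) (Complete G (⊤ - g))
proposition3p4 n G g sd =
  weakPointDeletions⇒weakReduces
    (deletions-resp-≐ʳ (complete-∖-≐ G ⊤ g)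
      (Peeling.peel (Complete G ⊤) (g ∈_) rank rank-injective weakPoint-resp-≐ rank<2^n
        (λ σ → (g ∈? σ) ×-dec complete? G ⊤ σ) (star-weakPoint G g sd)))
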